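{- For every feasible $f\in\mathbb{R}^E$ with tree induced voltages $v\in\mathbb{R}^V$, \[ \mathrm{gap}(f,v)=\sum_{e\in E\setminus T}\frac{\Delta_e(f)^2}{r_e}. \]
   Context: $G=(V,E,w)$ is a connected undirected graph with positive weights, resistances $r_e=1/w_e$, oriented edges ($f(b,a)=-f(a,b)$). $B\in\mathbb{R}^{E\times V}$ is the incidence matrix ($B_{(a,b),a}=1$, $B_{(a,b),b}=-1$), $R=\mathrm{diag}(r_e)$, $L=B^TR^{ -1}B$. Demand $\chi$ with $\sum_a\chi(a)=0$; $f$ feasible iff $B^Tf=\chi$; $\xi(f)=f^TRf$; dual energy $\xi^{\mathrm{dual}}(v)=2v^T\chi-v^TLv$; $\mathrm{gap}(f,v)=\xi(f)-\xi^{\mathrm{dual}}(v)$. $T$ is a spanning tree, $P_{(a,b)}$ the tree path from $a$ to $b$, $p_{(a,b)}$ the unit flow along it; for $e=(a,b)\in E\setminus T$, $c_e=\mathbf{1}_e+p_{(b,a)}$ and $\Delta_e(f)=f^TRc_e$. Tree induced voltages of $f$ with respect to a fixed vertex $s$: $v(a)=\sum_{e\in P_{(a,s)}}f(e)r_e$ ($f(e)$ signed by traversal direction).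
   Formalization: The resistances $r_e$, the demand $\chi$ and the flow $f$ are rational rather than real, so the weights and the tree induced voltages are rational as well. -}

module Defs where

open import Data.Nat using (ℕ; zero; suc)
open import Data.Fin using (Fin)
open import Data.Fin.Properties using () renaming (_≟_ to _≟ᶠ_)
open import Data.Bool using (Bool; true; false; if_then_else_)
open import Data.List using (List; []; _∷_)
open import Data.List.Relation.Unary.Unique.Propositional using (Unique)
open import Data.Product using (Σ; _×_; _,_)
open import Data.Rational using (ℚ; 0ℚ; 1ℚ; _+_; _*_; -_; _-_; Positive; 1/_)
open import Data.Rational.Properties using (pos⇒nonZero)
open import Relation.Binary.PropositionalEquality using (_≡_; _≢_)
open import Relation.Nullary using (¬_; yes; no)
open import Relation.Nullary.Decidable using (⌊_⌋)

Σᶠ : (k : ℕ) → (Fin k → ℚ) → ℚ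
Σᶠ zero    g = 0ℚ
Σᶠ (suc k) g = g Fin.zero + Σᶠ k (λ i → g (Fin.suc i))

-- A weighted undirected (simple, loopless) graph with vertex set Fin n and
-- edge set Fin m.  Edge e is oriented as e = (tl e , hd e).
record Graph (n m : ℕ) : Set where
  field
    tl hd  : Fin m → Fin n
    noLoop : ∀ e → tl e ≢ hd e
    simple : ∀ e e′ → e ≢ e′ →
               ¬ (tl e ≡ tl e′ × hd e ≡ hd e′) × ¬ (tl e ≡ hd e′ × hd e ≡ tl e′)
    r      : Fin m → ℚ
    r-pos  : ∀ e → Positive (r e)

module _ {n m : ℕ} (G : Graph n m) where
  open Graph G

  w : Fin m → ℚ
  w e = (1/ r e) {{pos⇒nonZero (r e) {{r-pos e}}}}

  B : Fin m → Fin n → ℚ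
  B e a with tl e ≟ᶠ a | hd e ≟ᶠ a
  ... | yes _ | _     = 1ℚ
  ... | no _  | yes _ = - 1ℚ
  ... | no _  | no _  = 0ℚ

  Bᵀ : (Fin m → ℚ) → Fin n → ℚ
  Bᵀ f a = Σᶠ m (λ e → B e a * f e)

  L : Fin n → Fin n → ℚ
  L a b = Σᶠ m (λ e → B e a * w e * B e b)

  IsDemand : (Fin n → ℚ) → Set
  IsDemand χ = Σᶠ n χ ≡ 0ℚ

  Feasible : (χ : Fin n → ℚ) (f : Fin m → ℚ) → Set
  Feasible χ f = ∀ a → Bᵀ f a ≡ χ a

  ξ : (Fin m → ℚ) → ℚ
  ξ f = Σᶠ m (λ e → f e * r e * f e)

  ξdual : (χ : Fin n → ℚ) → (Fin n → ℚ) → ℚ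
  ξdual χ v = (2ℚ * Σᶠ n (λ a → v a * χ a))
              - Σᶠ n (λ a → Σᶠ n (λ b → v a * L a b * v b))
    where 2ℚ = 1ℚ + 1ℚ

  gap : (χ : Fin n → ℚ) → (Fin m → ℚ) → (Fin n → ℚ) → ℚ
  gap χ f v = ξ f - ξdual χ v

  module _ (T : Fin m → Bool) where

    data Path : Fin n → Fin n → Set where
      stop : ∀ {a} → Path a a
      fwd  : ∀ {b} (e : Fin m) → T e ≡ true → Path (hd e) b → Path (tl e) b
      bwd  : ∀ {b} (e : Fin m) → T e ≡ true → Path (tl e) b → Path (hd e) b

    vertices : ∀ {a b} → Path a b → List (Fin n)
    vertices (stop {a})  = a ∷ []
    vertices (fwd e _ p) = tl e ∷ vertices p
    vertices (bwd e _ p) = hd e ∷ vertices p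

    edges : ∀ {a b} → Path a b → List (Fin m)
    edges stop        = []
    edges (fwd e _ p) = e ∷ edges p
    edges (bwd e _ p) = e ∷ edges p

    SimplePath : ∀ {a b} → Path a b → Set
    SimplePath p = Unique (vertices p)

    IsSpanningTree : Set
    IsSpanningTree =
      (∀ a b → Σ (Path a b) SimplePath) ×
      (∀ a b (p q : Path a b) → SimplePath p → SimplePath q → edges p ≡ edges q)

    pathFlow : ∀ {a b} → Path a b → Fin m → ℚ
    pathFlow stop        e′ = 0ℚ
    pathFlow (fwd e _ p) e′ = (if ⌊ e ≟ᶠ e′ ⌋ then 1ℚ else 0ℚ) + pathFlow p e′
    pathFlow (bwd e _ p) e′ = (if ⌊ e ≟ᶠ e′ ⌋ then - 1ℚ else 0ℚ) + pathFlow p e′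

    pathDrop : (Fin m → ℚ) → ∀ {a b} → Path a b → ℚ
    pathDrop f stop        = 0ℚ
    pathDrop f (fwd e _ p) = f e * r e + pathDrop f p
    pathDrop f (bwd e _ p) = (- f e) * r e + pathDrop f p

    module _ (P : ∀ a b → Path a b) where

      𝟙 : Fin m → Fin m → ℚ
      𝟙 e e′ = if ⌊ e ≟ᶠ e′ ⌋ then 1ℚ else 0ℚ

      c : Fin m → Fin m → ℚ
      c e e′ = 𝟙 e e′ + pathFlow (P (hd e) (tl e)) e′

      Δ : Fin m → (Fin m → ℚ) → ℚ
      Δ e f = Σᶠ m (λ e′ → f e′ * r e′ * c e e′)

      treeVoltages : (f : Fin m → ℚ) (s : Fin n) → Fin n → ℚ
      treeVoltages f s a = pathDrop f (P a s)

      offTreeSum : (Fin m → ℚ) → ℚ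
      offTreeSum f = Σᶠ m (λ e → if T e then 0ℚ else Δ e f * Δ e f * w e)

-- For any potential v, expanding the dual energy with χ = Bᵀf and L = Bᵀ R⁻¹ B
-- turns the gap into Σₑ (fₑrₑ − (v(a) − v(b)))² / rₑ, a sum of squared violations
-- of Ohm's law.  Tree induced voltages satisfy Ohm's law exactly on tree edges, and
-- on an off-tree edge e = (a,b) the violation fₑrₑ + v(b) − v(a) is the voltage drop
-- of f around the cycle c_e, i.e. Δ_e(f).  The one combinatorial input is that the
-- drop along any tree path from x to y is v(x) − v(y), which follows from uniqueness
-- of simple tree paths.
module Submission where

open import Defs
open import Algebra.Bundles using (Ring)
open import Data.Bool using (Bool; true; false; if_then_else_)
open import Data.Empty using (⊥-elim)
open import Data.Fin using (Fin; zero; suc)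
open import Data.Fin.Properties using () renaming (_≟_ to _≟ᶠ_)
open import Data.List using (_∷_)
open import Data.List.Properties using (∷-injective)
open import Data.List.Membership.Propositional using (_∈_)
open import Data.List.Relation.Binary.Subset.Propositional using (_⊆_)
open import Data.List.Relation.Binary.Subset.Propositional.Properties using (∷⁺ʳ; ∈-∷⁺ʳ)
open import Data.List.Relation.Unary.Any using (here; there)
open import Data.List.Relation.Unary.All using ([]; _∷_)
open import Data.List.Relation.Unary.All.Properties using (anti-mono)
open import Data.List.Relation.Unary.All.Properties.Core using (¬Any⇒All¬)
open import Data.List.Relation.Unary.AllPairs using ([]; _∷_)
open import Data.Nat as ℕ using (ℕ)
open import Data.Product using (_,_; proj₁; proj₂)
open import Data.Rational using (ℚ; 0ℚ; 1ℚ; _+_; _*_; -_; _-_)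
open import Data.Rational.Properties
  using (+-*-ring; +-identityˡ; +-identityʳ; +-assoc; +-inverseʳ; *-zeroˡ; *-zeroʳ; *-identityʳ; *-inverseˡ;
         *-distribˡ-+; neg-distribˡ-*; pos⇒nonZero)
open import Data.Rational.Solver using (module +-*-Solver)
open import Algebra.Properties.Semiring.Sum (Ring.semiring +-*-ring)
  using (sum; sum-cong-≗; sum-replicate-zero; ∑-distrib-+; ∑-comm; *-distribˡ-sum; *-distribʳ-sum)
open import Relation.Nullary using (yes; no)
open import Relation.Nullary.Decidable using (⌊_⌋)
open import Relation.Binary.PropositionalEquality

open +-*-Solver
open ≡-Reasoning

-- Finite sums

Σᶠ≡sum : ∀ k (g : Fin k → ℚ) → Σᶠ k g ≡ sum g
Σᶠ≡sum ℕ.zero    g = refl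
Σᶠ≡sum (ℕ.suc k) g = cong (g zero +_) (Σᶠ≡sum k (λ i → g (suc i)))

Σᶠ-cong : ∀ k {g h : Fin k → ℚ} → (∀ i → g i ≡ h i) → Σᶠ k g ≡ Σᶠ k h
Σᶠ-cong k {g} {h} g≗h = begin
  Σᶠ k g  ≡⟨ Σᶠ≡sum k g ⟩
  sum g   ≡⟨ sum-cong-≗ g≗h ⟩
  sum h   ≡⟨ Σᶠ≡sum k h ⟨
  Σᶠ k h  ∎

Σᶠ-zero : ∀ k → Σᶠ k (λ _ → 0ℚ) ≡ 0ℚ
Σᶠ-zero k = trans (Σᶠ≡sum k _) (sum-replicate-zero k)

Σᶠ-distrib-+ : ∀ k (g h : Fin k → ℚ) → Σᶠ k (λ i → g i + h i) ≡ Σᶠ k g + Σᶠ k h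
Σᶠ-distrib-+ k g h = begin
  Σᶠ k (λ i → g i + h i)  ≡⟨ Σᶠ≡sum k _ ⟩
  sum (λ i → g i + h i)   ≡⟨ ∑-distrib-+ g h ⟩
  sum g + sum h           ≡⟨ cong₂ _+_ (Σᶠ≡sum k g) (Σᶠ≡sum k h) ⟨
  Σᶠ k g + Σᶠ k h         ∎

*-distribˡ-Σᶠ : ∀ k x (g : Fin k → ℚ) → x * Σᶠ k g ≡ Σᶠ k (λ i → x * g i)
*-distribˡ-Σᶠ k x g = begin
  x * Σᶠ k g              ≡⟨ cong (x *_) (Σᶠ≡sum k g) ⟩
  x * sum g               ≡⟨ *-distribˡ-sum x g ⟩
  sum (λ i → x * g i)     ≡⟨ Σᶠ≡sum k _ ⟨
  Σᶠ k (λ i → x * g i)    ∎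

*-distribʳ-Σᶠ : ∀ k x (g : Fin k → ℚ) → Σᶠ k g * x ≡ Σᶠ k (λ i → g i * x)
*-distribʳ-Σᶠ k x g = begin
  Σᶠ k g * x              ≡⟨ cong (_* x) (Σᶠ≡sum k g) ⟩
  sum g * x               ≡⟨ *-distribʳ-sum x g ⟩
  sum (λ i → g i * x)     ≡⟨ Σᶠ≡sum k _ ⟨
  Σᶠ k (λ i → g i * x)    ∎

Σᶠ-comm : ∀ k l (g : Fin k → Fin l → ℚ) →
          Σᶠ k (λ i → Σᶠ l (g i)) ≡ Σᶠ l (λ j → Σᶠ k (λ i → g i j))
Σᶠ-comm k l g = begin
  Σᶠ k (λ i → Σᶠ l (g i))            ≡⟨ Σᶠ²≡sum² k l g ⟩
  sum (λ i → sum (g i))              ≡⟨ ∑-comm g ⟩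
  sum (λ j → sum (λ i → g i j))      ≡⟨ Σᶠ²≡sum² l k (λ j i → g i j) ⟨
  Σᶠ l (λ j → Σᶠ k (λ i → g i j))    ∎
  where
  Σᶠ²≡sum² : ∀ k l (g : Fin k → Fin l → ℚ) →
             Σᶠ k (λ i → Σᶠ l (g i)) ≡ sum (λ i → sum (g i))
  Σᶠ²≡sum² k l g = trans (Σᶠ≡sum k _) (sum-cong-≗ (λ i → Σᶠ≡sum l (g i)))

-- Definitionally the indicator 𝟙 of Defs, which also occurs inside pathFlow.
δ : ∀ {k} → Fin k → Fin k → ℚ
δ i j = if ⌊ i ≟ᶠ j ⌋ then 1ℚ else 0ℚ

Σᶠ-*δ : ∀ k (g : Fin k → ℚ) (i : Fin k) → Σᶠ k (λ j → g j * δ i j) ≡ g i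
Σᶠ-*δ (ℕ.suc k) g zero = begin
  g zero * 1ℚ + Σᶠ k (λ j → g (suc j) * 0ℚ)  ≡⟨ cong₂ _+_ (*-identityʳ (g zero))
                                                  (Σᶠ-cong k (λ j → *-zeroʳ (g (suc j)))) ⟩
  g zero + Σᶠ k (λ _ → 0ℚ)                    ≡⟨ cong (g zero +_) (Σᶠ-zero k) ⟩
  g zero + 0ℚ                                 ≡⟨ +-identityʳ (g zero) ⟩
  g zero                                      ∎
Σᶠ-*δ (ℕ.suc k) g (suc i) = begin
  g zero * 0ℚ + Σᶠ k (λ j → g (suc j) * δ (suc i) (suc j))
    ≡⟨ cong₂ _+_ (*-zeroʳ (g zero)) (Σᶠ-cong k (λ j → cong (g (suc j) *_) (δ-suc j))) ⟩
  0ℚ + Σᶠ k (λ j → g (suc j) * δ i j)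
    ≡⟨ +-identityˡ _ ⟩
  Σᶠ k (λ j → g (suc j) * δ i j)
    ≡⟨ Σᶠ-*δ k (λ j → g (suc j)) i ⟩
  g (suc i) ∎
  where
  δ-suc : ∀ j → δ (suc i) (suc j) ≡ δ i j
  δ-suc j with i ≟ᶠ j
  ... | yes _ = refl
  ... | no _  = refl

Σᶠ-*δ-+ : ∀ k (g h : Fin k → ℚ) (i : Fin k) → Σᶠ k (λ j → g j * δ i j + h j) ≡ g i + Σᶠ k h
Σᶠ-*δ-+ k g h i =
  trans (Σᶠ-distrib-+ k (λ j → g j * δ i j) h) (cong (_+ Σᶠ k h) (Σᶠ-*δ k g i))

Σᶠ-*[δ+] : ∀ k (g h : Fin k → ℚ) (i : Fin k) →
           Σᶠ k (λ j → g j * (δ i j + h j)) ≡ g i + Σᶠ k (λ j → g j * h j)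
Σᶠ-*[δ+] k g h i =
  trans (Σᶠ-cong k (λ j → *-distribˡ-+ (g j) (δ i j) (h j))) (Σᶠ-*δ-+ k g _ i)

-- Incidence matrix and duality gap

module _ {n m : ℕ} (G : Graph n m) where
  open Graph G

  grad : (Fin n → ℚ) → Fin m → ℚ
  grad v e = v (tl e) - v (hd e)

  ohmResidual : (Fin m → ℚ) → (Fin n → ℚ) → Fin m → ℚ
  ohmResidual f v e = f e * r e - grad v e

  w*r≡1 : ∀ e → w G e * r e ≡ 1ℚ
  w*r≡1 e = *-inverseˡ (r e) {{pos⇒nonZero (r e) {{r-pos e}}}}

  B≡δ-δ : ∀ e a → B G e a ≡ δ (tl e) a - δ (hd e) a
  B≡δ-δ e a with tl e ≟ᶠ a | hd e ≟ᶠ a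
  ... | yes tl≡a | yes hd≡a = ⊥-elim (noLoop e (trans tl≡a (sym hd≡a)))
  ... | yes _    | no _     = refl
  ... | no _     | yes _    = refl
  ... | no _     | no _     = refl

  Σᶠ-*B : ∀ (v : Fin n → ℚ) e → Σᶠ n (λ a → v a * B G e a) ≡ grad v e
  Σᶠ-*B v e = begin
    Σᶠ n (λ a → v a * B G e a)
      ≡⟨ Σᶠ-cong n (λ a → trans (cong (v a *_) (B≡δ-δ e a))
           (solve 3 (λ x p q → x :* (p :- q) := x :* p :+ (:- x) :* q) refl
             (v a) (δ (tl e) a) (δ (hd e) a))) ⟩
    Σᶠ n (λ a → v a * δ (tl e) a + (- v a) * δ (hd e) a)
      ≡⟨ Σᶠ-*δ-+ n v _ (tl e) ⟩
    v (tl e) + Σᶠ n (λ a → (- v a) * δ (hd e) a)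
      ≡⟨ cong (v (tl e) +_) (Σᶠ-*δ n (λ a → - v a) (hd e)) ⟩
    grad v e ∎

  Bᵀ-adjoint : ∀ (v : Fin n → ℚ) (f : Fin m → ℚ) →
               Σᶠ n (λ a → v a * Bᵀ G f a) ≡ Σᶠ m (λ e → f e * grad v e)
  Bᵀ-adjoint v f = begin
    Σᶠ n (λ a → v a * Bᵀ G f a)
      ≡⟨ Σᶠ-cong n (λ a → *-distribˡ-Σᶠ m (v a) _) ⟩
    Σᶠ n (λ a → Σᶠ m (λ e → v a * (B G e a * f e)))
      ≡⟨ Σᶠ-comm n m _ ⟩
    Σᶠ m (λ e → Σᶠ n (λ a → v a * (B G e a * f e)))
      ≡⟨ Σᶠ-cong m (λ e → Σᶠ-cong n (λ a →
           solve 3 (λ x b y → x :* (b :* y) := y :* (x :* b)) refl (v a) (B G e a) (f e))) ⟩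
    Σᶠ m (λ e → Σᶠ n (λ a → f e * (v a * B G e a)))
      ≡⟨ Σᶠ-cong m (λ e → trans (sym (*-distribˡ-Σᶠ n (f e) _)) (cong (f e *_) (Σᶠ-*B v e))) ⟩
    Σᶠ m (λ e → f e * grad v e) ∎

  L-factorisation : ∀ (u : Fin n → ℚ) a →
                    Σᶠ n (λ b → L G a b * u b) ≡ Bᵀ G (λ e → w G e * grad u e) a
  L-factorisation u a = begin
    Σᶠ n (λ b → L G a b * u b)
      ≡⟨ Σᶠ-cong n (λ b → *-distribʳ-Σᶠ m (u b) _) ⟩
    Σᶠ n (λ b → Σᶠ m (λ e → B G e a * w G e * B G e b * u b))
      ≡⟨ Σᶠ-comm n m _ ⟩
    Σᶠ m (λ e → Σᶠ n (λ b → B G e a * w G e * B G e b * u b))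
      ≡⟨ Σᶠ-cong m (λ e → Σᶠ-cong n (λ b →
           solve 4 (λ p x q y → p :* x :* q :* y := p :* x :* (y :* q)) refl
             (B G e a) (w G e) (B G e b) (u b))) ⟩
    Σᶠ m (λ e → Σᶠ n (λ b → B G e a * w G e * (u b * B G e b)))
      ≡⟨ Σᶠ-cong m (λ e → trans (sym (*-distribˡ-Σᶠ n (B G e a * w G e) _))
           (trans (cong (B G e a * w G e *_) (Σᶠ-*B u e))
             (solve 3 (λ p x d → p :* x :* d := p :* (x :* d)) refl (B G e a) (w G e) (grad u e)))) ⟩
    Bᵀ G (λ e → w G e * grad u e) a ∎

  L-quadraticForm : ∀ (v : Fin n → ℚ) →
                    Σᶠ n (λ a → Σᶠ n (λ b → v a * L G a b * v b))
                      ≡ Σᶠ m (λ e → w G e * grad v e * grad v e)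
  L-quadraticForm v = begin
    Σᶠ n (λ a → Σᶠ n (λ b → v a * L G a b * v b))
      ≡⟨ Σᶠ-cong n (λ a → trans (Σᶠ-cong n (λ b →
           solve 3 (λ x l y → x :* l :* y := x :* (l :* y)) refl (v a) (L G a b) (v b)))
           (sym (*-distribˡ-Σᶠ n (v a) _))) ⟩
    Σᶠ n (λ a → v a * Σᶠ n (λ b → L G a b * v b))
      ≡⟨ Σᶠ-cong n (λ a → cong (v a *_) (L-factorisation v a)) ⟩
    Σᶠ n (λ a → v a * Bᵀ G (λ e → w G e * grad v e) a)
      ≡⟨ Bᵀ-adjoint v _ ⟩
    Σᶠ m (λ e → w G e * grad v e * grad v e) ∎

  ohmResidual² : ∀ (f : Fin m → ℚ) v e →
    ohmResidual f v e * ohmResidual f v e * w G e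
      ≡ f e * r e * f e + (- (1ℚ + 1ℚ)) * (f e * grad v e) + w G e * grad v e * grad v e
  ohmResidual² f v e = begin
    (f e * r e - d) * (f e * r e - d) * w G e
      ≡⟨ solve 4 (λ f r w d → (f :* r :- d) :* (f :* r :- d) :* w
           := f :* r :* f :* (w :* r) :+ con (- (1ℚ + 1ℚ)) :* (f :* d) :* (w :* r) :+ w :* d :* d)
           refl (f e) (r e) (w G e) d ⟩
    f e * r e * f e * (w G e * r e) + (- (1ℚ + 1ℚ)) * (f e * d) * (w G e * r e) + w G e * d * d
      ≡⟨ cong (λ x → f e * r e * f e * x + (- (1ℚ + 1ℚ)) * (f e * d) * x + w G e * d * d)
              (w*r≡1 e) ⟩
    f e * r e * f e * 1ℚ + (- (1ℚ + 1ℚ)) * (f e * d) * 1ℚ + w G e * d * d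
      ≡⟨ solve 3 (λ a b c → a :* con 1ℚ :+ b :* con 1ℚ :+ c := a :+ b :+ c) refl
           (f e * r e * f e) ((- (1ℚ + 1ℚ)) * (f e * d)) (w G e * d * d) ⟩
    f e * r e * f e + (- (1ℚ + 1ℚ)) * (f e * d) + w G e * d * d ∎
    where d = grad v e

  gap≡Σᶠ-ohmResidual² : ∀ {χ f} → Feasible G χ f → ∀ v →
    gap G χ f v ≡ Σᶠ m (λ e → ohmResidual f v e * ohmResidual f v e * w G e)
  gap≡Σᶠ-ohmResidual² {χ} {f} feasible v = begin
    gap G χ f v
      ≡⟨ cong₂ (λ x y → ξ G f - ((1ℚ + 1ℚ) * x - y)) vᵀχ≡ (L-quadraticForm v) ⟩
    ξ G f - ((1ℚ + 1ℚ) * Σᶠ m fd - Σᶠ m wdd)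
      ≡⟨ solve 3 (λ a x y → a :- ((con 1ℚ :+ con 1ℚ) :* x :- y) := a :+ con (- (1ℚ + 1ℚ)) :* x :+ y)
           refl (ξ G f) (Σᶠ m fd) (Σᶠ m wdd) ⟩
    ξ G f + (- (1ℚ + 1ℚ)) * Σᶠ m fd + Σᶠ m wdd
      ≡⟨ cong (λ x → ξ G f + x + Σᶠ m wdd) (*-distribˡ-Σᶠ m (- (1ℚ + 1ℚ)) fd) ⟩
    ξ G f + Σᶠ m (λ e → (- (1ℚ + 1ℚ)) * fd e) + Σᶠ m wdd
      ≡⟨ cong (_+ Σᶠ m wdd) (Σᶠ-distrib-+ m _ _) ⟨
    Σᶠ m (λ e → f e * r e * f e + (- (1ℚ + 1ℚ)) * fd e) + Σᶠ m wdd
      ≡⟨ Σᶠ-distrib-+ m _ _ ⟨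
    Σᶠ m (λ e → f e * r e * f e + (- (1ℚ + 1ℚ)) * fd e + wdd e)
      ≡⟨ Σᶠ-cong m (λ e → ohmResidual² f v e) ⟨
    Σᶠ m (λ e → ohmResidual f v e * ohmResidual f v e * w G e) ∎
    where
    fd wdd : Fin m → ℚ
    fd e = f e * grad v e
    wdd e = w G e * grad v e * grad v e
    vᵀχ≡ : Σᶠ n (λ a → v a * χ a) ≡ Σᶠ m fd
    vᵀχ≡ = trans (Σᶠ-cong n (λ a → cong (v a *_) (sym (feasible a)))) (Bᵀ-adjoint v f)

-- Voltage drops along tree paths

module _ {n m : ℕ} (G : Graph n m) (T : Fin m → Bool) (f : Fin m → ℚ) where
  open Graph G

  edges-≡⇒pathDrop-≡ : ∀ {a a′ b} (p : Path G T a b) (q : Path G T a′ b) → a ≡ a′ →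
                       edges G T p ≡ edges G T q → pathDrop G T f p ≡ pathDrop G T f q
  edges-≡⇒pathDrop-≡ stop        stop         _ _    = refl
  edges-≡⇒pathDrop-≡ (fwd e _ p) (fwd e′ _ q) _ e∷≡ =
    cong₂ _+_ (cong (λ x → f x * r x) e≡e′)
              (edges-≡⇒pathDrop-≡ p q (cong hd e≡e′) (proj₂ (∷-injective e∷≡)))
    where e≡e′ = proj₁ (∷-injective e∷≡)
  edges-≡⇒pathDrop-≡ (bwd e _ p) (bwd e′ _ q) _ e∷≡ =
    cong₂ _+_ (cong (λ x → (- f x) * r x) e≡e′)
              (edges-≡⇒pathDrop-≡ p q (cong tl e≡e′) (proj₂ (∷-injective e∷≡)))
    where e≡e′ = proj₁ (∷-injective e∷≡)
  edges-≡⇒pathDrop-≡ (fwd e _ p) (bwd e′ _ q) tl≡hd e∷≡ =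
    ⊥-elim (noLoop e (trans tl≡hd (cong hd (sym (proj₁ (∷-injective e∷≡))))))
  edges-≡⇒pathDrop-≡ (bwd e _ p) (fwd e′ _ q) hd≡tl e∷≡ =
    ⊥-elim (noLoop e (sym (trans hd≡tl (cong tl (sym (proj₁ (∷-injective e∷≡)))))))

  record SplitAt {y b : Fin n} (p : Path G T y b) (a : Fin n) : Set where
    field
      prefix         : Path G T y a
      suffix         : Path G T a b
      prefix-simple  : SimplePath G T prefix
      suffix-simple  : SimplePath G T suffix
      prefix-⊆       : vertices G T prefix ⊆ vertices G T p
      pathDrop-split : pathDrop G T f p ≡ pathDrop G T f prefix + pathDrop G T f suffix

  start∈vertices : ∀ {a b} (p : Path G T a b) → a ∈ vertices G T p
  start∈vertices stop        = here refl
  start∈vertices (fwd _ _ _) = here refl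
  start∈vertices (bwd _ _ _) = here refl

  splitAtStart : ∀ {y b} (p : Path G T y b) → SimplePath G T p → SplitAt p y
  splitAtStart p p-simple = record
    { prefix         = stop
    ; suffix         = p
    ; prefix-simple  = [] ∷ []
    ; suffix-simple  = p-simple
    ; prefix-⊆       = ∈-∷⁺ʳ (start∈vertices p) (λ ())
    ; pathDrop-split = sym (+-identityˡ _)
    }

  splitAt : ∀ {y b a} (p : Path G T y b) → SimplePath G T p → a ∈ vertices G T p → SplitAt p a
  splitAt stop        p-simple (here refl) = splitAtStart stop p-simple
  splitAt (fwd e t p) p-simple (here refl) = splitAtStart (fwd e t p) p-simple
  splitAt (bwd e t p) p-simple (here refl) = splitAtStart (bwd e t p) p-simple
  splitAt (fwd e t p) (tl∉p ∷ p-simple) (there a∈p) = record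
    { prefix         = fwd e t prefix
    ; suffix         = suffix
    ; prefix-simple  = anti-mono prefix-⊆ tl∉p ∷ prefix-simple
    ; suffix-simple  = suffix-simple
    ; prefix-⊆       = ∷⁺ʳ (tl e) prefix-⊆
    ; pathDrop-split = trans (cong (f e * r e +_) pathDrop-split)
                              (sym (+-assoc (f e * r e) _ _))
    }
    where open SplitAt (splitAt p p-simple a∈p)
  splitAt (bwd e t p) (hd∉p ∷ p-simple) (there a∈p) = record
    { prefix         = bwd e t prefix
    ; suffix         = suffix
    ; prefix-simple  = anti-mono prefix-⊆ hd∉p ∷ prefix-simple
    ; suffix-simple  = suffix-simple
    ; prefix-⊆       = ∷⁺ʳ (hd e) prefix-⊆
    ; pathDrop-split = trans (cong ((- f e) * r e +_) pathDrop-split)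
                              (sym (+-assoc ((- f e) * r e) _ _))
    }
    where open SplitAt (splitAt p p-simple a∈p)

module _ {n m : ℕ} (G : Graph n m) (T : Fin m → Bool) (f : Fin m → ℚ) where
  open Graph G

  private
    fr : Fin m → ℚ
    fr e = f e * r e

  Σᶠ-*pathFlow : ∀ {a b} (p : Path G T a b) → Σᶠ m (λ e → fr e * pathFlow G T p e) ≡ pathDrop G T f p
  Σᶠ-*pathFlow stop = trans (Σᶠ-cong m (λ e → *-zeroʳ (fr e))) (Σᶠ-zero m)
  Σᶠ-*pathFlow (fwd e _ p) =
    trans (Σᶠ-*[δ+] m fr (pathFlow G T p) e) (cong (fr e +_) (Σᶠ-*pathFlow p))
  Σᶠ-*pathFlow (bwd e _ p) = begin
    Σᶠ m (λ e′ → fr e′ * ((if ⌊ e ≟ᶠ e′ ⌋ then - 1ℚ else 0ℚ) + pathFlow G T p e′))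
      ≡⟨ Σᶠ-cong m (λ e′ → trans (cong (λ x → fr e′ * (x + pathFlow G T p e′)) (−δ e′))
           (solve 3 (λ x d y → x :* (:- d :+ y) := (:- x) :* d :+ x :* y) refl
             (fr e′) (δ e e′) (pathFlow G T p e′))) ⟩
    Σᶠ m (λ e′ → (- fr e′) * δ e e′ + fr e′ * pathFlow G T p e′)
      ≡⟨ Σᶠ-*δ-+ m (λ e′ → - fr e′) _ e ⟩
    - fr e + Σᶠ m (λ e′ → fr e′ * pathFlow G T p e′)
      ≡⟨ cong₂ _+_ (neg-distribˡ-* (f e) (r e)) (Σᶠ-*pathFlow p) ⟩
    (- f e) * r e + pathDrop G T f p ∎
    where
    −δ : ∀ e′ → (if ⌊ e ≟ᶠ e′ ⌋ then - 1ℚ else 0ℚ) ≡ - δ e e′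
    −δ e′ with ⌊ e ≟ᶠ e′ ⌋
    ... | true  = refl
    ... | false = refl

  Δ≡fr+pathDrop : ∀ (P : ∀ a b → Path G T a b) e →
                  Δ G T P e f ≡ fr e + pathDrop G T f (P (hd e) (tl e))
  Δ≡fr+pathDrop P e =
    trans (Σᶠ-*[δ+] m fr (pathFlow G T (P (hd e) (tl e))) e)
          (cong (fr e +_) (Σᶠ-*pathFlow (P (hd e) (tl e))))

module _ {n m : ℕ} (G : Graph n m) (T : Fin m → Bool)
  (unique : ∀ a b (p q : Path G T a b) → SimplePath G T p → SimplePath G T q →
            edges G T p ≡ edges G T q)
  (P : ∀ a b → Path G T a b) (P-simple : ∀ a b → SimplePath G T (P a b))
  (f : Fin m → ℚ) (s : Fin n) where
  open Graph G
  open import Data.List.Membership.DecPropositional (_≟ᶠ_ {n}) using (_∈?_)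

  private
    v : Fin n → ℚ
    v = treeVoltages G T P f s

  simple-pathDrop-≡ : ∀ {a b} (p q : Path G T a b) → SimplePath G T p → SimplePath G T q →
                      pathDrop G T f p ≡ pathDrop G T f q
  simple-pathDrop-≡ p q p-simple q-simple =
    edges-≡⇒pathDrop-≡ G T f p q refl (unique _ _ p q p-simple q-simple)

  -- Either tl e is off the tree path from hd e to s, and e followed by that path is
  -- the tree path from tl e; or it is on it, and the part before tl e is e reversed.
  treeVoltage-step : ∀ e → T e ≡ true → v (tl e) ≡ f e * r e + v (hd e)
  treeVoltage-step e t with tl e ∈? vertices G T (P (hd e) s)
  ... | no tl∉ = simple-pathDrop-≡ (P (tl e) s) (fwd e t (P (hd e) s))
                   (P-simple _ _) (¬Any⇒All¬ _ tl∉ ∷ P-simple _ _)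
  ... | yes tl∈ = begin
    v (tl e)
      ≡⟨ solve 3 (λ f r x → x := f :* r :+ ((:- f) :* r :+ con 0ℚ :+ x)) refl (f e) (r e) (v (tl e)) ⟩
    f e * r e + (pathDrop G T f back + v (tl e))
      ≡⟨ cong (f e * r e +_) (cong₂ _+_
           (simple-pathDrop-≡ back prefix back-simple prefix-simple)
           (simple-pathDrop-≡ (P (tl e) s) suffix (P-simple _ _) suffix-simple)) ⟩
    f e * r e + (pathDrop G T f prefix + pathDrop G T f suffix)
      ≡⟨ cong (f e * r e +_) pathDrop-split ⟨
    f e * r e + v (hd e) ∎
    where
    open SplitAt (splitAt G T f (P (hd e) s) (P-simple _ _) tl∈)
    back : Path G T (hd e) (tl e)
    back = bwd e t stop
    back-simple : SimplePath G T back
    back-simple = ((λ hd≡tl → noLoop e (sym hd≡tl)) ∷ []) ∷ [] ∷ []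

  pathDrop≡voltageDrop : ∀ {a b} (p : Path G T a b) → pathDrop G T f p ≡ v a - v b
  pathDrop≡voltageDrop {a} stop = sym (+-inverseʳ (v a))
  pathDrop≡voltageDrop {b = b} (fwd e t p) = begin
    f e * r e + pathDrop G T f p  ≡⟨ cong (f e * r e +_) (pathDrop≡voltageDrop p) ⟩
    f e * r e + (v (hd e) - v b)  ≡⟨ solve 3 (λ x y z → x :+ (y :- z) := (x :+ y) :- z) refl
                                       (f e * r e) (v (hd e)) (v b) ⟩
    (f e * r e + v (hd e)) - v b  ≡⟨ cong (_- v b) (treeVoltage-step e t) ⟨
    v (tl e) - v b                ∎
  pathDrop≡voltageDrop {b = b} (bwd e t p) = begin
    (- f e) * r e + pathDrop G T f p
      ≡⟨ cong ((- f e) * r e +_) (pathDrop≡voltageDrop p) ⟩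
    (- f e) * r e + (v (tl e) - v b)
      ≡⟨ cong (λ x → (- f e) * r e + (x - v b)) (treeVoltage-step e t) ⟩
    (- f e) * r e + (f e * r e + v (hd e) - v b)
      ≡⟨ solve 4 (λ f r y z → (:- f) :* r :+ (f :* r :+ y :- z) := y :- z) refl
           (f e) (r e) (v (hd e)) (v b) ⟩
    v (hd e) - v b ∎

  ohmResidual-tree : ∀ e → T e ≡ true → ohmResidual G f v e ≡ 0ℚ
  ohmResidual-tree e t = begin
    f e * r e - (v (tl e) - v (hd e))
      ≡⟨ cong (λ x → f e * r e - (x - v (hd e))) (treeVoltage-step e t) ⟩
    f e * r e - (f e * r e + v (hd e) - v (hd e))
      ≡⟨ solve 2 (λ x y → x :- (x :+ y :- y) := con 0ℚ) refl (f e * r e) (v (hd e)) ⟩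
    0ℚ ∎

  Δ≡ohmResidual : ∀ e → Δ G T P e f ≡ ohmResidual G f v e
  Δ≡ohmResidual e = begin
    Δ G T P e f
      ≡⟨ Δ≡fr+pathDrop G T f P e ⟩
    f e * r e + pathDrop G T f (P (hd e) (tl e))
      ≡⟨ cong (f e * r e +_) (pathDrop≡voltageDrop (P (hd e) (tl e))) ⟩
    f e * r e + (v (hd e) - v (tl e))
      ≡⟨ solve 3 (λ x a b → x :+ (b :- a) := x :- (a :- b)) refl (f e * r e) (v (tl e)) (v (hd e)) ⟩
    f e * r e - (v (tl e) - v (hd e)) ∎

mainTheorem8 : (n m : ℕ) (G : Graph n m) (T : Fin m → Bool)
    → IsSpanningTree G T
    → (P : ∀ a b → Path G T a b) → (∀ a b → SimplePath G T (P a b))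
    → (s : Fin n) (χ : Fin n → ℚ) → IsDemand G χ
    → (f : Fin m → ℚ) → Feasible G χ f
    → gap G χ f (treeVoltages G T P f s) ≡ offTreeSum G T P f
mainTheorem8 n m G T (_ , unique) P P-simple s χ _ f feasible = begin
  gap G χ f v                            ≡⟨ gap≡Σᶠ-ohmResidual² G feasible v ⟩
  Σᶠ m (λ e → ρ e * ρ e * w G e)        ≡⟨ Σᶠ-cong m offTree-only ⟩
  offTreeSum G T P f                     ∎
  where
  v : Fin n → ℚ
  v = treeVoltages G T P f s
  ρ : Fin m → ℚ
  ρ = ohmResidual G f v
  offTree-only : ∀ e → ρ e * ρ e * w G e ≡ (if T e then 0ℚ else Δ G T P e f * Δ G T P e f * w G e)
  offTree-only e with T e in onTree
  ... | true  = trans (cong (λ x → x * x * w G e) (ohmResidual-tree G T unique P P-simple f s e onTree))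
                      (*-zeroˡ (w G e))
  ... | false = cong (λ x → x * x * w G e) (sym (Δ≡ohmResidual G T unique P P-simple f s e))
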